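{- The complete graph $K_7$ has nonorientable embeddings of type $(6)$, of type $(5,4)$, and of type $(4,4,4)$.
   Context: Embeddings are cellular embeddings of graphs in closed surfaces; a nonorientable embedding is one in a nonorientable surface. The length of a face is the number of corners on its boundary walk. An embedding is of type $(a_1,\dotsc,a_i)$, with $a_1 \geq \dots \geq a_i > 3$, if it has exactly $i$ nontriangular faces, of lengths $a_1,\dotsc,a_i$, and all other faces are triangles. -}

module Defs where

open import Data.Nat using (ℕ; zero; suc; _+_; _*_; _≤_; _<_; _≟_)
open import Data.Fin using (Fin) renaming (_≟_ to _≟ᶠ_)
open import Data.Bool using (Bool; true; false; if_then_else_; _xor_) renaming (_≟_ to _≟ᵇ_)
open import Data.Product using (Σ; _×_; _,_)
open import Data.List using (List; []; _∷_; length; filter; concatMap; allFin)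
import Data.Product.Properties as PP
open import Relation.Nullary using (¬_; yes; no; Dec)
open import Relation.Nullary.Decidable using (⌊_⌋)
open import Relation.Binary.PropositionalEquality using (_≡_; _≢_)
open import Relation.Binary using (DecidableEquality)
open import Data.List.Membership.Propositional using (_∈_)

V : Set
V = Fin 7

iter : {A : Set} → (A → A) → ℕ → A → A
iter f zero    x = x
iter f (suc k) x = f (iter f k x)

-- A general (signed) rotation system of K₇ (Heffter–Edmonds–Ringel / Mohar–Thomassen):
-- at every vertex v, ρ v is a cyclic ordering of the six other vertices (given as a
-- permutation of Fin 7 fixing v, with explicit inverse ρ⁻ v, acting on the other six
-- vertices as a single 6-cycle), and every edge uv carries a signature tw u v
-- (true = twisted / negative edge).  These are exactly the cellular embeddings of K₇
-- in closed surfaces (up to equivalence).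
record GRS : Set where
  field
    ρ     : V → V → V
    ρ⁻    : V → V → V
    ρ-fix : ∀ v → ρ v v ≡ v
    ρ-inv₁ : ∀ v u → ρ⁻ v (ρ v u) ≡ u
    ρ-inv₂ : ∀ v u → ρ v (ρ⁻ v u) ≡ u
    ρ-cyc : ∀ v u → u ≢ v → ∀ k → 1 ≤ k → k < 6 → iter (ρ v) k u ≢ u
    tw    : V → V → Bool
    tw-sym : ∀ u v → tw u v ≡ tw v u

-- Face-tracing states: (u , v , s) = traversing the edge u→v, currently in mode s
-- (false: use ρ, true: use ρ⁻), mode flipped on twisted edges.
State : Set
State = V × V × Bool

_≟ˢ_ : DecidableEquality State
_≟ˢ_ = PP.≡-dec _≟ᶠ_ (PP.≡-dec _≟ᶠ_ _≟ᵇ_)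

module _ (R : GRS) where
  open GRS R

  step : State → State
  step (u , v , s) =
    let s' = s xor tw u v in
    (v , (if s' then ρ⁻ v u else ρ v u) , s')

  -- The genuine states: both endpoints distinct, both modes (4·|E| = 84 of them).
  darts : List State
  darts = concatMap (λ u → concatMap (λ v →
            if ⌊ u ≟ᶠ v ⌋ then [] else ((u , v , false) ∷ (u , v , true) ∷ []))
            (allFin 7)) (allFin 7)

  period : ℕ → ℕ → State → State → ℕ
  period zero    k x y = 0
  period (suc n) k x y =
    if ⌊ step y ≟ˢ x ⌋ then k else period n (suc k) x (step y)

  -- Length of the face traced from state x = least k ≥ 1 with stepᵏ x = x
  -- (the orbit of a genuine state has size ≤ 84).
  faceLen : State → ℕ
  faceLen x = period 84 1 x x

  -- Every face of
  -- length ℓ is traced by exactly two orbits (one per direction) of size ℓ, so a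
  -- face of length ℓ contributes exactly 2ℓ states.
  statesOfLen : ℕ → ℕ
  statesOfLen ℓ = length (filter (λ x → faceLen x ≟ ℓ) darts)

  -- Orientable: some sequence of local switches makes all edges untwisted, i.e.
  -- the signature is a coboundary.
  Orientable : Set
  Orientable = Σ (V → Bool) λ f → ∀ u v → u ≢ v → tw u v ≡ f u xor f v

  Nonorientable : Set
  Nonorientable = ¬ Orientable

count : ℕ → List ℕ → ℕ
count ℓ []       = 0
count ℓ (a ∷ as) = if ⌊ a ≟ ℓ ⌋ then suc (count ℓ as) else count ℓ as

-- The embedding has type L (L lists the lengths, all > 3, of the nontriangular
-- faces with multiplicity): every face has length ≥ 3 and, for every ℓ ≥ 4, the
-- number of faces of length ℓ equals the multiplicity of ℓ in L.  (So all other
-- faces are triangles.)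
HasType : GRS → List ℕ → Set
HasType R L =
  (∀ x → x ∈ darts R → 3 ≤ faceLen R x) ×
  (∀ ℓ → 4 ≤ ℓ → statesOfLen R ℓ ≡ 2 * ℓ * count ℓ L)

-- A signed rotation system of K₇ is finite data, so whether it satisfies the
-- rotation axioms and what its faces are can be decided by evaluation; once all
-- faces are known to be shorter than 7, the type condition concerns only the
-- lengths 4, 5 and 6.  Nonorientability is witnessed by a triangle with an odd
-- number of twisted edges: a coboundary sums to zero around every closed walk.
module Submission where

open import Defs
open import Data.Nat using (ℕ; _*_; _≤_; _<_; _≟_; _≤?_; _<?_)
open import Data.Nat.Properties using (allUpTo?; <⇒≢; <-≤-trans; <-≤-connex; *-zeroʳ)
open import Data.Fin using () renaming (_≟_ to _≟ᶠ_)
open import Data.Fin.Patterns using (0F; 1F; 2F; 3F; 4F; 5F; 6F)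
import Data.Fin.Properties as Fin
open import Data.Bool using (Bool; true; false; if_then_else_; _∨_; _xor_)
open import Data.Bool.Properties using (∨-comm)
open import Data.List using (List; []; _∷_; _∷ʳ_; zip; map; length; filter)
open import Data.List.Properties using (filter-none)
open import Data.List.Relation.Unary.All as All using (All; []; _∷_)
import Data.List.Membership.DecPropositional as DecMembership
open import Data.Product using (Σ; _×_; _,_; swap)
open import Data.Sum using ([_,_]′)
import Data.Product.Properties as Product
open import Function using (_∘_)
open import Relation.Nullary using (Dec; yes; no; ¬?; contradiction)
open import Relation.Nullary.Decidable using (⌊_⌋; True; toWitness; _×-dec_; _→-dec_)
open import Relation.Binary.Definitions using (DecidableEquality)
open import Relation.Binary.PropositionalEquality using (_≡_; _≢_; refl; sym; cong; cong₂; module ≡-Reasoning)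

coboundary-triangle : ∀ x y z → (x xor y) xor (y xor z) xor (z xor x) ≡ false
coboundary-triangle false false false = refl
coboundary-triangle false false true  = refl
coboundary-triangle false true  false = refl
coboundary-triangle false true  true  = refl
coboundary-triangle true  false false = refl
coboundary-triangle true  false true  = refl
coboundary-triangle true  true  false = refl
coboundary-triangle true  true  true  = refl

oddTriangle⇒nonorientable : (R : GRS) {a b c : V} → a ≢ b → b ≢ c → c ≢ a →
  let open GRS R in tw a b xor tw b c xor tw c a ≡ true → Nonorientable R
oddTriangle⇒nonorientable R {a} {b} {c} a≢b b≢c c≢a odd (f , tw≡δf) = false≢true (begin
  false                                             ≡⟨ sym (coboundary-triangle (f a) (f b) (f c)) ⟩
  (f a xor f b) xor (f b xor f c) xor (f c xor f a) ≡⟨ cong₂ _xor_ (sym (tw≡δf a b a≢b))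
                                                        (cong₂ _xor_ (sym (tw≡δf b c b≢c)) (sym (tw≡δf c a c≢a))) ⟩
  tw a b xor tw b c xor tw c a                      ≡⟨ odd ⟩
  true                                              ∎)
  where
  open GRS R
  open ≡-Reasoning
  false≢true : false ≢ true
  false≢true ()

module CyclicOrder {A : Set} (_≟_ : DecidableEquality A) where
  lookupOrSelf : List (A × A) → A → A
  lookupOrSelf []             u = u
  lookupOrSelf ((a , b) ∷ ps) u = if ⌊ u ≟ a ⌋ then b else lookupOrSelf ps u

  consecutivePairs : List A → List (A × A)
  consecutivePairs []       = []
  consecutivePairs (x ∷ xs) = zip (x ∷ xs) (xs ∷ʳ x)

  cyclicSuccessor cyclicPredecessor : List A → A → A
  cyclicSuccessor   = lookupOrSelf ∘ consecutivePairs
  cyclicPredecessor = lookupOrSelf ∘ map swap ∘ consecutivePairs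

module SignedRotation (rotation : V → List V) (twisted : List (V × V)) where
  open CyclicOrder {A = V} _≟ᶠ_ using (cyclicSuccessor; cyclicPredecessor)
  open DecMembership {A = V × V} (Product.≡-dec _≟ᶠ_ _≟ᶠ_) using (_∈?_)

  ρ ρ⁻ : V → V → V
  ρ  = cyclicSuccessor ∘ rotation
  ρ⁻ = cyclicPredecessor ∘ rotation

  listed : V → V → Bool
  listed u v = ⌊ (u , v) ∈? twisted ⌋

  tw : V → V → Bool
  tw u v = listed u v ∨ listed v u

  tw-sym : ∀ u v → tw u v ≡ tw v u
  tw-sym u v = ∨-comm (listed u v) (listed v u)

  RotationAxioms : Set
  RotationAxioms =
    (∀ v → ρ v v ≡ v) ×
    (∀ v u → ρ⁻ v (ρ v u) ≡ u) ×
    (∀ v u → ρ v (ρ⁻ v u) ≡ u) ×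
    (∀ v u → u ≢ v → ∀ {k} → k < 6 → 1 ≤ k → iter (ρ v) k u ≢ u)

  rotationAxioms? : Dec RotationAxioms
  rotationAxioms? =
    Fin.all? (λ v → ρ v v ≟ᶠ v) ×-dec
    Fin.all? (λ v → Fin.all? λ u → ρ⁻ v (ρ v u) ≟ᶠ u) ×-dec
    Fin.all? (λ v → Fin.all? λ u → ρ v (ρ⁻ v u) ≟ᶠ u) ×-dec
    Fin.all? (λ v → Fin.all? λ u → ¬? (u ≟ᶠ v) →-dec
      allUpTo? (λ k → 1 ≤? k →-dec ¬? (iter (ρ v) k u ≟ᶠ u)) 6)

  embedding : True rotationAxioms? → GRS
  embedding axioms =
    let fix , inv₁ , inv₂ , cyc = toWitness axioms
    in  record
      { ρ = ρ ; ρ⁻ = ρ⁻ ; ρ-fix = fix ; ρ-inv₁ = inv₁ ; ρ-inv₂ = inv₂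
      ; ρ-cyc = λ v u u≢v k 1≤k k<6 → cyc v u u≢v k<6 1≤k
      ; tw = tw ; tw-sym = tw-sym }

count-beyond : ∀ {n ℓ} L → All (_< n) L → n ≤ ℓ → count ℓ L ≡ 0
count-beyond []      []           n≤ℓ = refl
count-beyond {ℓ = ℓ} (a ∷ L) (a<n ∷ L<n) n≤ℓ with a ≟ ℓ
... | yes a≡ℓ = contradiction a≡ℓ (<⇒≢ (<-≤-trans a<n n≤ℓ))
... | no  _   = count-beyond L L<n n≤ℓ

length-filter-beyond : ∀ {A : Set} (f : A → ℕ) {n ℓ} (xs : List A) → All (λ x → f x < n) xs → n ≤ ℓ →
                       length (filter (λ x → f x ≟ ℓ) xs) ≡ 0
length-filter-beyond f {ℓ = ℓ} xs bounded n≤ℓ =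
  cong length (filter-none (λ x → f x ≟ ℓ) (All.map (λ fx<n → <⇒≢ (<-≤-trans fx<n n≤ℓ)) bounded))

hasType-fromBound : ∀ (R : GRS) (L : List ℕ) {n} →
  All (λ x → 3 ≤ faceLen R x) (darts R) →
  All (λ x → faceLen R x < n) (darts R) →
  All (_< n) L →
  (∀ {ℓ} → ℓ < n → 4 ≤ ℓ → statesOfLen R ℓ ≡ 2 * ℓ * count ℓ L) →
  HasType R L
hasType-fromBound R L {n} nontrivial bounded L<n below = (λ _ → All.lookup nontrivial) , counts
  where
  open ≡-Reasoning
  beyond : ∀ ℓ → n ≤ ℓ → statesOfLen R ℓ ≡ 2 * ℓ * count ℓ L
  beyond ℓ n≤ℓ = begin
    statesOfLen R ℓ     ≡⟨ length-filter-beyond (faceLen R) (darts R) bounded n≤ℓ ⟩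
    0                   ≡⟨ sym (*-zeroʳ (2 * ℓ)) ⟩
    2 * ℓ * 0           ≡⟨ cong (2 * ℓ *_) (sym (count-beyond L L<n n≤ℓ)) ⟩
    2 * ℓ * count ℓ L   ∎

  counts : ∀ ℓ → 4 ≤ ℓ → statesOfLen R ℓ ≡ 2 * ℓ * count ℓ L
  -- ℓ is given explicitly: inferring it would make Agda normalise statesOfLen R.
  counts ℓ 4≤ℓ = [ (λ ℓ<n → below {ℓ} ℓ<n 4≤ℓ) , beyond ℓ ]′ (<-≤-connex ℓ n)

module _ (R : GRS) (L : List ℕ) (n : ℕ) where
  typeWithFacesBelow? :
    Dec (All (λ x → 3 ≤ faceLen R x) (darts R) ×
         All (λ x → faceLen R x < n) (darts R) ×
         All (_< n) L ×
         (∀ {ℓ} → ℓ < n → 4 ≤ ℓ → statesOfLen R ℓ ≡ 2 * ℓ * count ℓ L))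
  typeWithFacesBelow? =
    All.all? (λ x → 3 ≤? faceLen R x) (darts R) ×-dec
    All.all? (λ x → faceLen R x <? n) (darts R) ×-dec
    All.all? (_<? n) L ×-dec
    allUpTo? (λ ℓ → 4 ≤? ℓ →-dec statesOfLen R ℓ ≟ 2 * ℓ * count ℓ L) n

  hasType-byEvaluation : True typeWithFacesBelow? → HasType R L
  hasType-byEvaluation certificate =
    let nontrivial , bounded , L<n , below = toWitness certificate
    in  hasType-fromBound R L nontrivial bounded L<n below

K₇⟨6⟩ : GRS
K₇⟨6⟩ = SignedRotation.embedding rotation twisted _
  where
  rotation : V → List V
  rotation 0F = 1F ∷ 6F ∷ 3F ∷ 5F ∷ 2F ∷ 4F ∷ []
  rotation 1F = 0F ∷ 6F ∷ 2F ∷ 3F ∷ 5F ∷ 4F ∷ []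
  rotation 2F = 0F ∷ 5F ∷ 6F ∷ 1F ∷ 3F ∷ 4F ∷ []
  rotation 3F = 0F ∷ 2F ∷ 4F ∷ 6F ∷ 1F ∷ 5F ∷ []
  rotation 4F = 0F ∷ 1F ∷ 5F ∷ 6F ∷ 3F ∷ 2F ∷ []
  rotation 5F = 0F ∷ 2F ∷ 6F ∷ 4F ∷ 1F ∷ 3F ∷ []
  rotation 6F = 0F ∷ 3F ∷ 4F ∷ 5F ∷ 2F ∷ 1F ∷ []
  twisted : List (V × V)
  twisted =
    (0F , 1F) ∷ (0F , 4F) ∷ (0F , 5F) ∷ (0F , 6F) ∷ (1F , 2F) ∷ (1F , 3F) ∷
    (2F , 3F) ∷ (2F , 4F) ∷ (2F , 5F) ∷ (2F , 6F) ∷ (3F , 5F) ∷ []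

K₇⟨5,4⟩ : GRS
K₇⟨5,4⟩ = SignedRotation.embedding rotation twisted _
  where
  rotation : V → List V
  rotation 0F = 1F ∷ 5F ∷ 2F ∷ 4F ∷ 6F ∷ 3F ∷ []
  rotation 1F = 0F ∷ 3F ∷ 4F ∷ 6F ∷ 2F ∷ 5F ∷ []
  rotation 2F = 0F ∷ 5F ∷ 3F ∷ 6F ∷ 1F ∷ 4F ∷ []
  rotation 3F = 0F ∷ 1F ∷ 4F ∷ 5F ∷ 2F ∷ 6F ∷ []
  rotation 4F = 0F ∷ 6F ∷ 1F ∷ 3F ∷ 5F ∷ 2F ∷ []
  rotation 5F = 0F ∷ 2F ∷ 3F ∷ 4F ∷ 6F ∷ 1F ∷ []
  rotation 6F = 0F ∷ 3F ∷ 2F ∷ 5F ∷ 1F ∷ 4F ∷ []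
  twisted : List (V × V)
  twisted =
    (0F , 3F) ∷ (0F , 4F) ∷ (0F , 5F) ∷ (0F , 6F) ∷ (1F , 3F) ∷ (1F , 5F) ∷
    (2F , 3F) ∷ (2F , 4F) ∷ (2F , 5F) ∷ (2F , 6F) ∷ (3F , 4F) ∷ (4F , 5F) ∷ []

K₇⟨4,4,4⟩ : GRS
K₇⟨4,4,4⟩ = SignedRotation.embedding rotation twisted _
  where
  rotation : V → List V
  rotation 0F = 1F ∷ 2F ∷ 4F ∷ 3F ∷ 5F ∷ 6F ∷ []
  rotation 1F = 0F ∷ 6F ∷ 2F ∷ 4F ∷ 3F ∷ 5F ∷ []
  rotation 2F = 0F ∷ 4F ∷ 3F ∷ 6F ∷ 1F ∷ 5F ∷ []
  rotation 3F = 0F ∷ 5F ∷ 1F ∷ 4F ∷ 2F ∷ 6F ∷ []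
  rotation 4F = 0F ∷ 2F ∷ 3F ∷ 1F ∷ 5F ∷ 6F ∷ []
  rotation 5F = 0F ∷ 6F ∷ 4F ∷ 2F ∷ 1F ∷ 3F ∷ []
  rotation 6F = 0F ∷ 1F ∷ 2F ∷ 3F ∷ 4F ∷ 5F ∷ []
  twisted : List (V × V)
  twisted =
    (0F , 2F) ∷ (0F , 3F) ∷ (0F , 5F) ∷ (0F , 6F) ∷ (1F , 2F) ∷ (1F , 6F) ∷
    (2F , 3F) ∷ (2F , 4F) ∷ (2F , 5F) ∷ (3F , 6F) ∷ []

mainTheorem16 :
    (Σ GRS λ R → Nonorientable R × HasType R (6 ∷ [])) ×
    (Σ GRS λ R → Nonorientable R × HasType R (5 ∷ 4 ∷ [])) ×
    (Σ GRS λ R → Nonorientable R × HasType R (4 ∷ 4 ∷ 4 ∷ []))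
mainTheorem16 =
  (K₇⟨6⟩ ,
    oddTriangle⇒nonorientable K₇⟨6⟩ {0F} {2F} {3F} (λ ()) (λ ()) (λ ()) refl ,
    hasType-byEvaluation K₇⟨6⟩ (6 ∷ []) 7 _) ,
  (K₇⟨5,4⟩ ,
    oddTriangle⇒nonorientable K₇⟨5,4⟩ {0F} {1F} {4F} (λ ()) (λ ()) (λ ()) refl ,
    hasType-byEvaluation K₇⟨5,4⟩ (5 ∷ 4 ∷ []) 7 _) ,
  (K₇⟨4,4,4⟩ ,
    oddTriangle⇒nonorientable K₇⟨4,4,4⟩ {0F} {1F} {3F} (λ ()) (λ ()) (λ ()) refl ,
    hasType-byEvaluation K₇⟨4,4,4⟩ (4 ∷ 4 ∷ 4 ∷ []) 7 _)
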